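{- Let $G^<$ be a connected ordered graph, let $n$ be a positive integer, and set $N = r_<(G^<,K^<_n)$. Then for every $M\geq N$, every red-blue coloring of the edges of $K^<_M$ either contains a blue copy of $K^<_n$ or there are $M-N+1$ vertices of $K^<_M$ each of which is the rightmost vertex of some red copy of $G^<$.
   Context: An ordered graph on $N$ vertices is a graph with vertex set $[N]=\{1,\dots,N\}$ ordered by the usual order of integers. An ordered graph $G^<$ on $[n]$ is an ordered subgraph of an ordered graph $H^<$ on $[N]$ if there is a map $\phi:[n]\to[N]$ with $\phi(i)<\phi(j)$ whenever $i<j$ such that $\{\phi(i),\phi(j)\}$ is an edge of $H^<$ whenever $\{i,j\}$ is an edge of $G^<$; the image is a copy of $G^<$, and its rightmost vertex is $\phi(n)$. $K^<_N$ is the complete ordered graph on $[N]$. The ordered Ramsey number $r_<(G^<,H^<)$ is the least $N$ such that every red-blue coloring of the edges of $K^<_N$ contains a red copy of $G^<$ or a blue copy of $H^<$ as an ordered subgraph. -}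

module Defs where

open import Data.Nat using (ℕ; suc; _≤_)
open import Data.Fin using (Fin; _<_; fromℕ)
open import Data.Product using (Σ; ∃; _×_; _,_)
open import Relation.Binary.PropositionalEquality using (_≡_; _≢_; refl) renaming (sym to ≡-sym)
open import Relation.Nullary using (¬_)
open import Function.Definitions using (Injective)
open import Data.Sum using (_⊎_)

record OrdGraph (n : ℕ) : Set₁ where
  field
    Adj    : Fin n → Fin n → Set
    sym    : ∀ {i j} → Adj i j → Adj j i
    irrefl : ∀ {i} → ¬ Adj i i
open OrdGraph public

K< : (n : ℕ) → OrdGraph n
K< n = record { Adj = λ i j → i ≢ j ; sym = λ p q → p (≡-sym q) ; irrefl = λ p → p refl }

data Reach {n : ℕ} (G : OrdGraph n) (i : Fin n) : Fin n → Set where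
  here : Reach G i i
  step : ∀ {j k} → Reach G i j → Adj G j k → Reach G i k

-- connected: nonempty (ensured by the index suc k below) and any two vertices joined by a path
Connected : {n : ℕ} → OrdGraph n → Set
Connected {n} G = ∀ (i j : Fin n) → Reach G i j

data Colour : Set where
  red blue : Colour

-- a red-blue colouring of the edges of K_M: the colour of edge {a,b} with a < b is c a b
Colouring : ℕ → Set
Colouring M = Fin M → Fin M → Colour

Monotone : {n M : ℕ} → (Fin n → Fin M) → Set
Monotone {n} φ = ∀ {i j : Fin n} → i < j → φ i < φ j

IsCopy : {n M : ℕ} → Colouring M → Colour → OrdGraph n → (Fin n → Fin M) → Set
IsCopy c col G φ = Monotone φ × (∀ {i j} → i < j → Adj G i j → c (φ i) (φ j) ≡ col)

HasCopy : {n M : ℕ} → Colouring M → Colour → OrdGraph n → Set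
HasCopy {n} {M} c col G = Σ (Fin n → Fin M) (IsCopy c col G)

Arrows : {k l : ℕ} → OrdGraph k → OrdGraph l → ℕ → Set
Arrows G H N = (c : Colouring N) → HasCopy c red G ⊎ HasCopy c blue H

IsOrdRamsey : {k l : ℕ} → OrdGraph k → OrdGraph l → ℕ → Set
IsOrdRamsey G H N = Arrows G H N × (∀ m → Arrows G H m → N ≤ m)

RightmostRed : {k M : ℕ} → Colouring M → OrdGraph (suc k) → Fin M → Set
RightmostRed {k} c G v = Σ (Fin (suc k) → _) λ φ → IsCopy c red G φ × (φ (fromℕ k) ≡ v)

-- Induction on M - N. Among any N vertices there is a blue K_n or a red copy of G; in the latter
-- case record its rightmost vertex v, delete v, and recurse on the remaining M - 1 ≥ N vertices.
-- The recorded vertices are distinct because each one is deleted before the next is found.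
module Submission where

open import Defs
open import Data.Nat using (ℕ; suc; zero; _≤_; _∸_; _+_; s≤s)
open import Data.Nat.Properties using (m∸n+n≡m; <⇒≤)
open import Data.Fin using (Fin; punchIn; fromℕ; _↑ʳ_) renaming (zero to fzero; suc to fsuc)
import Data.Fin as Fin
open import Data.Fin.Properties
  using (punchIn-injective; punchInᵢ≢i; punchIn-mono-≤; ≤∧≢⇒<; <⇒≢)
open import Data.Product using (Σ; _×_; _,_; proj₂)
open import Data.Sum using (_⊎_; inj₁; inj₂)
import Data.Sum as Sum
open import Data.Empty using (⊥-elim)
open import Function using (_∘_)
open import Function.Definitions using (Injective)
open import Relation.Binary.PropositionalEquality using (_≡_; refl; cong) renaming (sym to ≡-sym)

punchIn-mono-< : ∀ {m} (i : Fin (suc m)) {j k : Fin m} → j Fin.< k → punchIn i j Fin.< punchIn i k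
punchIn-mono-< i {j} {k} j<k =
  ≤∧≢⇒< (punchIn-mono-≤ i j k (<⇒≤ j<k)) (<⇒≢ j<k ∘ punchIn-injective i j k)

↑ʳ-mono-< : ∀ {m} d {j k : Fin m} → j Fin.< k → (d ↑ʳ j) Fin.< (d ↑ʳ k)
↑ʳ-mono-< zero    j<k = j<k
↑ʳ-mono-< (suc d) j<k = s≤s (↑ʳ-mono-< d j<k)

_along_ : ∀ {m M} → Colouring M → (Fin m → Fin M) → Colouring m
(c along ψ) x y = c (ψ x) (ψ y)

module _ {m M : ℕ} (c : Colouring M) (ψ : Fin m → Fin M) (ψ-mono : Monotone ψ) where

  IsCopy-along : ∀ {a col} (G : OrdGraph a) φ → IsCopy (c along ψ) col G φ → IsCopy c col G (ψ ∘ φ)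
  IsCopy-along G φ (φ-mono , coloured) = ψ-mono ∘ φ-mono , coloured

  HasCopy-along : ∀ {a col} (G : OrdGraph a) → HasCopy (c along ψ) col G → HasCopy c col G
  HasCopy-along G (φ , copy) = ψ ∘ φ , IsCopy-along G φ copy

  RightmostRed-along : ∀ {k} (G : OrdGraph (suc k)) {v} →
                       RightmostRed (c along ψ) G v → RightmostRed c G (ψ v)
  RightmostRed-along G (φ , copy , rightmost) = ψ ∘ φ , IsCopy-along G φ copy , cong ψ rightmost

Arrows-↑ʳ : ∀ {a b N} (G : OrdGraph a) (H : OrdGraph b) → Arrows G H N → ∀ d → Arrows G H (d + N)
Arrows-↑ʳ G H arrows d c =
  Sum.map (HasCopy-along c (d ↑ʳ_) (↑ʳ-mono-< d) G) (HasCopy-along c (d ↑ʳ_) (↑ʳ-mono-< d) H)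
          (arrows (c along (d ↑ʳ_)))

RightmostReds : ∀ {k M} → Colouring M → OrdGraph (suc k) → ℕ → Set
RightmostReds {M = M} c G s =
  Σ (Fin s → Fin M) λ S → Injective _≡_ _≡_ S × (∀ t → RightmostRed c G (S t))

module _ {k M : ℕ} (c : Colouring M) (G : OrdGraph (suc k)) {v : Fin M}
         (v-red : RightmostRed c G v) where

  RightmostReds-singleton : RightmostReds c G 1
  RightmostReds-singleton = (λ _ → v) , injective , λ { fzero → v-red }
    where
    injective : Injective _≡_ _≡_ (λ (_ : Fin 1) → v)
    injective {fzero} {fzero} _ = refl

module _ {k M : ℕ} (c : Colouring (suc M)) (G : OrdGraph (suc k)) {v : Fin (suc M)}
         (v-red : RightmostRed c G v) where

  RightmostReds-insert : ∀ {s} → RightmostReds (c along punchIn v) G s → RightmostReds c G (suc s)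
  RightmostReds-insert (S , S-injective , S-red) = T , T-injective , T-red
    where
    T : Fin (suc _) → Fin (suc M)
    T fzero    = v
    T (fsuc t) = punchIn v (S t)

    T-injective : Injective _≡_ _≡_ T
    T-injective {fzero}  {fzero}  _  = refl
    T-injective {fzero}  {fsuc u} eq = ⊥-elim (punchInᵢ≢i v (S u) (≡-sym eq))
    T-injective {fsuc t} {fzero}  eq = ⊥-elim (punchInᵢ≢i v (S t) eq)
    T-injective {fsuc t} {fsuc u} eq = cong fsuc (S-injective (punchIn-injective v (S t) (S u) eq))

    T-red : ∀ t → RightmostRed c G (T t)
    T-red fzero    = v-red
    T-red (fsuc t) = RightmostRed-along c (punchIn v) (punchIn-mono-< v) G (S-red t)

HasCopy⇒RightmostRed : ∀ {k M} (c : Colouring M) (G : OrdGraph (suc k)) →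
                      HasCopy c red G → Σ (Fin M) (RightmostRed c G)
HasCopy⇒RightmostRed {k} c G (φ , copy) = φ (fromℕ k) , φ , copy , refl

blueOrRightmostRed : ∀ {k b M} (G : OrdGraph (suc k)) (H : OrdGraph b) → Arrows G H M →
                     (c : Colouring M) → HasCopy c blue H ⊎ Σ (Fin M) (RightmostRed c G)
blueOrRightmostRed G H arrows c = Sum.swap (Sum.map₁ (HasCopy⇒RightmostRed c G) (arrows c))

module _ {k b N : ℕ} (G : OrdGraph (suc k)) (H : OrdGraph b) (arrows : Arrows G H N) where

  rightmostReds : ∀ d (c : Colouring (d + N)) → HasCopy c blue H ⊎ RightmostReds c G (d + 1)
  rightmostReds zero    c =
    Sum.map₂ (RightmostReds-singleton c G ∘ proj₂) (blueOrRightmostRed G H arrows c)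
  rightmostReds (suc d) c with blueOrRightmostRed G H (Arrows-↑ʳ G H arrows (suc d)) c
  ... | inj₁ blueH       = inj₁ blueH
  ... | inj₂ (v , v-red) = Sum.map (HasCopy-along c (punchIn v) (punchIn-mono-< v) H)
                                   (RightmostReds-insert c G v-red)
                                   (rightmostReds d (c along punchIn v))

lemma21 : (k : ℕ) (G : OrdGraph (suc k)) → Connected G →
    (n : ℕ) → 1 ≤ n → (N : ℕ) → IsOrdRamsey G (K< n) N →
    (M : ℕ) → N ≤ M → (c : Colouring M) →
    HasCopy c blue (K< n)
    ⊎ Σ (Fin (M ∸ N + 1) → Fin M)
    (λ S → Injective _≡_ _≡_ S × (∀ t → RightmostRed c G (S t)))
lemma21 k G _ n _ N (arrows , _) M N≤M = withExcess (M ∸ N) (m∸n+n≡m N≤M)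
  where
  withExcess : ∀ d → d + N ≡ M → (c : Colouring M) → HasCopy c blue (K< n) ⊎ RightmostReds c G (d + 1)
  withExcess d refl = rightmostReds G (K< n) arrows d
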